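{- $\mathsf{TC}_1(\mathtt b)$ proves: if $x$ and $y$ are $\mathtt b$-free and $x*\mathtt b*u=y*\mathtt b*v$, then $x=y$ and $u=v$.
   Context: $\mathsf{TC}_1$ is the theory in the language with a constant $\varnothing$ and binary function $*$, axiomatised by: $\varnothing*x=x\wedge x*\varnothing=x$; $x*y=\varnothing\to(x=\varnothing\wedge y=\varnothing)$; $(x*y)*z=x*(y*z)$; and $x*y=u*v\to\exists w\,((x*w=u\wedge y=w*v)\vee(x=u*w\wedge w*y=v))$. An atom is an $a\neq\varnothing$ such that for all $x,y$, if $x*y=a$ then $x=\varnothing$ or $y=\varnothing$. $\mathsf{TC}_1(\mathtt b)$ is $\mathsf{TC}_1$ with a new constant $\mathtt b$ and the axiom that $\mathtt b$ is an atom. $x\preceq y$ means $\exists u\,\exists v\,y=(u*x)*v$, and $x$ is $\mathtt b$-free if $\mathtt b\not\preceq x$. -}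

module Defs where

open import Level using (Level; suc)
open import Data.Product using (Σ; ∃; _×_; _,_)
open import Data.Sum using (_⊎_)
open import Relation.Nullary using (¬_)
open import Relation.Binary.PropositionalEquality using (_≡_; _≢_)

-- A model of the theory TC₁(b): a carrier with ∅, *, and constant b,
-- satisfying the TC₁ axioms and the axiom that b is an atom.
-- Equality of the first-order language is interpreted as _≡_.

module _ {ℓ : Level} {A : Set ℓ} (∅ : A) (_*_ : A → A → A) where

  IsAtom : A → Set ℓ
  IsAtom a = (a ≢ ∅) × (∀ x y → x * y ≡ a → (x ≡ ∅) ⊎ (y ≡ ∅))

  _⪯_ : A → A → Set ℓ
  x ⪯ y = Σ A λ u → Σ A λ v → y ≡ (u * x) * v

record TC₁b (ℓ : Level) : Set (suc ℓ) where
  infixl 7 _*_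
  field
    Carrier : Set ℓ
    ∅       : Carrier
    _*_     : Carrier → Carrier → Carrier
    b       : Carrier
    ∅-idˡ   : ∀ x → ∅ * x ≡ x
    ∅-idʳ   : ∀ x → x * ∅ ≡ x
    ∅-split : ∀ x y → x * y ≡ ∅ → (x ≡ ∅) × (y ≡ ∅)
    assoc   : ∀ x y z → (x * y) * z ≡ x * (y * z)
    editor  : ∀ x y u v → x * y ≡ u * v →
              Σ Carrier λ w → ((x * w ≡ u) × (y ≡ w * v)) ⊎ ((x ≡ u * w) × (w * y ≡ v))
    b-atom  : IsAtom ∅ _*_ b

  BFree : Carrier → Set ℓ
  BFree x = ¬ (_⪯_ ∅ _*_ b x)

{-# OPTIONS --safe #-}
module Submission where

-- By the editor axiom, x * (b * u) = y * (b * v) makes one of x, y a prefix of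
-- the other, say y = x * w with b * u = w * (b * v).  Editing this second
-- equation, either w starts with b or w is a prefix of the atom b, i.e. w = ∅
-- or w = b.  Everything but w = ∅ puts b inside y, contradicting b-freeness;
-- so x = y, and b * u = b * v gives u = v because an atom is left-cancellable.

open import Defs
open import Level using (Level)
open import Data.Product using (_×_; _,_; proj₁; proj₂)
open import Data.Sum using (inj₁; inj₂)
open import Data.Empty using (⊥-elim)
open import Relation.Nullary using (¬_)
open import Relation.Binary.PropositionalEquality
  using (_≡_; refl; sym; trans; cong; subst; module ≡-Reasoning)

module Properties {ℓ : Level} (M : TC₁b ℓ) where
  open TC₁b M
  open ≡-Reasoning

  b≢∅ : ¬ b ≡ ∅
  b≢∅ = proj₁ b-atom

  b*w≡b⇒w≡∅ : ∀ w → b * w ≡ b → w ≡ ∅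
  b*w≡b⇒w≡∅ w eq with proj₂ b-atom b w eq
  ... | inj₁ b≡∅ = ⊥-elim (b≢∅ b≡∅)
  ... | inj₂ w≡∅ = w≡∅

  b-cancelˡ : ∀ u v → b * u ≡ b * v → u ≡ v
  b-cancelˡ u v eq with editor b u b v eq
  ... | w , inj₁ (b*w≡b , u≡w*v) = begin
    u      ≡⟨ u≡w*v ⟩
    w * v  ≡⟨ cong (_* v) (b*w≡b⇒w≡∅ w b*w≡b) ⟩
    ∅ * v  ≡⟨ ∅-idˡ v ⟩
    v      ∎
  ... | w , inj₂ (b≡b*w , w*u≡v) = begin
    u      ≡⟨ sym (∅-idˡ u) ⟩
    ∅ * u  ≡⟨ cong (_* u) (sym (b*w≡b⇒w≡∅ w (sym b≡b*w))) ⟩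
    w * u  ≡⟨ w*u≡v ⟩
    v      ∎

  ¬BFree-*b* : ∀ x w → ¬ BFree (x * (b * w))
  ¬BFree-*b* x w free = free (x , w , sym (assoc x b w))

  ¬BFree-*b : ∀ x → ¬ BFree (x * b)
  ¬BFree-*b x free = ¬BFree-*b* x ∅ (subst (λ z → BFree (x * z)) (sym (∅-idʳ b)) free)

  overlap≡∅ : ∀ x w y u v → x * w ≡ y → b * u ≡ w * (b * v) → BFree y → w ≡ ∅
  overlap≡∅ x w y u v refl eq free with editor b u w (b * v) eq
  ... | w′ , inj₁ (b*w′≡w , _) =
    ⊥-elim (¬BFree-*b* x w′ (subst (λ z → BFree (x * z)) (sym b*w′≡w) free))
  ... | w′ , inj₂ (b≡w*w′ , _) with proj₂ b-atom w w′ (sym b≡w*w′)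
  ...   | inj₁ w≡∅ = w≡∅
  ...   | inj₂ w′≡∅ = ⊥-elim (¬BFree-*b x (subst (λ z → BFree (x * z)) w≡b free))
    where
    w≡b : w ≡ b
    w≡b = begin
      w       ≡⟨ sym (∅-idʳ w) ⟩
      w * ∅   ≡⟨ cong (w *_) (sym w′≡∅) ⟩
      w * w′  ≡⟨ sym b≡w*w′ ⟩
      b       ∎

  overlap-cancel : ∀ x w y u v → x * w ≡ y → b * u ≡ w * (b * v) → BFree y → (x ≡ y) × (u ≡ v)
  overlap-cancel x w y u v x*w≡y eq free with overlap≡∅ x w y u v x*w≡y eq free
  ... | refl = trans (sym (∅-idʳ x)) x*w≡y
             , b-cancelˡ u v (trans eq (∅-idˡ (b * v)))

open Properties using (overlap-cancel)

mainTheorem18 : ∀ {ℓ : Level} (M : TC₁b ℓ) → let open TC₁b M in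
    ∀ x y u v → BFree x → BFree y → x * b * u ≡ y * b * v → (x ≡ y) × (u ≡ v)
mainTheorem18 M x y u v free-x free-y eq
  with editor x (b * u) y (b * v) (trans (sym (assoc x b u)) (trans eq (assoc y b v)))
  where open TC₁b M
... | w , inj₁ (x*w≡y , b*u≡w*b*v) = overlap-cancel M x w y u v x*w≡y b*u≡w*b*v free-y
... | w , inj₂ (x≡y*w , w*b*u≡b*v) with overlap-cancel M y w x v u (sym x≡y*w) (sym w*b*u≡b*v) free-x
...   | y≡x , v≡u = sym y≡x , sym v≡u
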